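{- Let $f:\mathbb{R}\to\mathbb{R}$ be positive on every prime, and assume $m!_f$ is a natural number for every nonnegative integer $m$. Then for arbitrary nonnegative integers $n,k$, the natural number $(n+k)!_f$ is a multiple of $n!_f\, k!_f$.
   Context: $\mathbb{P}$ is the set of primes and $\lfloor\cdot\rfloor$ the floor function. For $f:\mathbb{R}\to\mathbb{R}$ positive on $\mathbb{P}$, the $f$-factorial is $n!_f=\prod_{p\in\mathbb{P}} p^{\sum_{k\ge 0}\lfloor n/(f(p)p^k)\rfloor}$. -}

module Defs where

open import Level using (0ℓ)
open import Data.Nat as ℕ using (ℕ; zero; suc; _^_)
open import Data.Nat.Primality using (Prime; prime?)
open import Data.Integer as ℤ using (ℤ; +_; -[1+_])
open import Data.Product using (Σ; ∃; _×_; _,_)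
open import Data.Sum using (_⊎_)
open import Relation.Nullary using (¬_; yes; no)
open import Relation.Binary.PropositionalEquality using (_≡_; _≢_)
open import Relation.Binary.Structures using (IsStrictTotalOrder)
open import Algebra.Structures using (IsCommutativeRing)

embℕ : {A : Set} → A → A → (A → A → A) → ℕ → A
embℕ z o plus zero    = z
embℕ z o plus (suc n) = plus (embℕ z o plus n) o

embℤ : {A : Set} → A → A → (A → A → A) → (A → A) → ℤ → A
embℤ z o plus neg (+ n)    = embℕ z o plus n
embℤ z o plus neg -[1+ n ] = neg (embℕ z o plus (suc n))

-- The real numbers, axiomatised as a complete ordered field
-- (unique up to isomorphism), together with its floor function.

record RealField : Set₁ where
  infixl 6 _+_
  infixl 7 _*_
  infix 4 _<_ _≤_
  field
    Carrier : Set
    _+_ _*_ : Carrier → Carrier → Carrier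
    -_      : Carrier → Carrier
    0# 1#   : Carrier
    _⁻¹     : Carrier → Carrier
    _<_     : Carrier → Carrier → Set
    isCommutativeRing   : IsCommutativeRing _≡_ _+_ _*_ -_ 0# 1#
    0≢1                 : 0# ≢ 1#
    ⁻¹-inverse          : ∀ x → x ≢ 0# → x * (x ⁻¹) ≡ 1#
    <-isStrictTotalOrder : IsStrictTotalOrder _≡_ _<_
    +-mono-<            : ∀ {x y} z → x < y → x + z < y + z
    *-pos               : ∀ {x y} → 0# < x → 0# < y → 0# < x * y

  _≤_ : Carrier → Carrier → Set
  x ≤ y = x < y ⊎ x ≡ y

  field
    sup : (S : Carrier → Set) → ∃ S → (∃ λ b → ∀ x → S x → x ≤ b) →
          ∃ λ s → (∀ x → S x → x ≤ s) × (∀ b → (∀ x → S x → x ≤ b) → s ≤ b)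

  fromℕ : ℕ → Carrier
  fromℕ = embℕ 0# 1# _+_

  fromℤ : ℤ → Carrier
  fromℤ = embℤ 0# 1# _+_ -_

  field
    ⌊_⌋        : Carrier → ℤ
    ⌊⌋-lower   : ∀ x → fromℤ ⌊ x ⌋ ≤ x
    ⌊⌋-upper   : ∀ x → x < fromℤ ⌊ x ⌋ + 1#

  _/_ : Carrier → Carrier → Carrier
  x / y = x * (y ⁻¹)

module FFactorial (R : RealField) where
  open RealField R

  PositiveOnPrimes : (Carrier → Carrier) → Set
  PositiveOnPrimes f = ∀ p → Prime p → 0# < f (fromℕ p)

  -- the k-th summand ⌊ n / (f(p) p^k) ⌋ of the exponent of p in n!_f
  term : (Carrier → Carrier) → (p n k : ℕ) → ℤ
  term f p n k = ⌊ fromℕ n / (f (fromℕ p) * fromℕ (p ^ k)) ⌋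

  partialSum : (Carrier → Carrier) → (p n K : ℕ) → ℤ
  partialSum f p n zero    = + 0
  partialSum f p n (suc K) = partialSum f p n K ℤ.+ term f p n K

  -- the series Σ_{k ≥ 0} ⌊ n / (f(p) p^k) ⌋ converges (its terms being
  -- integers) to the value e
  HasExponent : (Carrier → Carrier) → (p n : ℕ) → ℕ → Set
  HasExponent f p n e =
    ∃ λ K → (∀ k → K ℕ.≤ k → term f p n k ≡ + 0) × (partialSum f p n K ≡ + e)

  primeProduct : (ℕ → ℕ) → ℕ → ℕ
  primeProduct e zero    = 1
  primeProduct e (suc B) with prime? (suc B)
  ... | yes _ = primeProduct e B ℕ.* (suc B ^ e (suc B))
  ... | no  _ = primeProduct e B

  -- IsFFact f n N : the f-factorial n!_f = ∏_{p prime} p^{e_p} (an infinite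
  -- product, i.e. the limit of its partial products over p ≤ B) equals
  -- the natural number N.
  IsFFact : (Carrier → Carrier) → ℕ → ℕ → Set
  IsFFact f n N =
    ∃ λ (e : ℕ → ℕ) → (∀ p → Prime p → HasExponent f p n (e p)) ×
      (∃ λ B → ∀ B′ → B ℕ.≤ B′ → primeProduct e B′ ≡ N)

{-# OPTIONS --safe #-}
module Submission where

-- Legendre's formula gives, for each prime p, the exponent of p in n!_f as
-- Σ_k ⌊n / (f(p) p^k)⌋.  The floor function is superadditive,
-- ⌊x⌋ + ⌊y⌋ ≤ ⌊x + y⌋, so termwise the exponent of p in n!_f k!_f is at most
-- its exponent in (n + k)!_f; comparing prime by prime gives the divisibility.

open import Defs
open import Level using (0ℓ)
open import Algebra.Bundles using (CommutativeRing; AbelianGroup)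
open import Algebra.Structures using (IsCommutativeRing)
import Algebra.Properties.CommutativeSemigroup as CommutativeSemigroupProperties
import Algebra.Properties.Group as GroupProperties
open import Data.Nat as ℕ using (ℕ; zero; suc)
import Data.Nat.Properties as ℕ
open import Data.Integer as ℤ using (ℤ; -[1+_])
import Data.Integer.Properties as ℤ
open import Data.Nat.Divisibility using (_∣_; divides; ∣-refl; *-pres-∣)
open import Data.Nat.Primality using (Prime; prime?)
open import Data.Product using (∃; _×_; _,_)
open import Data.Sum using (inj₁; inj₂)
open import Data.Empty using (⊥-elim)
open import Relation.Nullary using (yes; no)
open import Relation.Binary.Definitions using (tri<; tri≈; tri>)
open import Relation.Binary.Structures using (IsStrictTotalOrder; IsStrictPartialOrder; IsPartialOrder)
import Relation.Binary.Construct.StrictToNonStrict as StrictToNonStrict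
open import Relation.Binary.PropositionalEquality

module RealFieldProperties (R : RealField) where
  open RealField R
  open IsCommutativeRing isCommutativeRing
    using (+-assoc; +-comm; +-identityˡ; +-identityʳ; -‿inverseʳ; distribʳ)
  open IsStrictTotalOrder <-isStrictTotalOrder using (compare; isStrictPartialOrder)
  open IsStrictPartialOrder isStrictPartialOrder using (irrefl) renaming (trans to <-trans)
  open IsPartialOrder (StrictToNonStrict.isPartialOrder _≡_ _<_ isStrictPartialOrder)
    using () renaming (trans to ≤-trans)

  commutativeRing : CommutativeRing 0ℓ 0ℓ
  commutativeRing = record { isCommutativeRing = isCommutativeRing }

  open CommutativeRing commutativeRing using (ring; +-commutativeSemigroup)

  open import Algebra.Properties.Ring ring using (-0#≈0#; -‿involutive; -‿+-comm; -1*x≈-x)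
  open CommutativeSemigroupProperties +-commutativeSemigroup using (interchange)

  <-≤-trans : ∀ {x y z} → x < y → y ≤ z → x < z
  <-≤-trans = StrictToNonStrict.<-≤-trans _≡_ _<_ <-trans (λ {x} → subst (x <_))

  fromℕ-+ : ∀ m n → fromℕ (m ℕ.+ n) ≡ fromℕ m + fromℕ n
  fromℕ-+ m zero = trans (cong fromℕ (ℕ.+-identityʳ m)) (sym (+-identityʳ _))
  fromℕ-+ m (suc n) = begin
    fromℕ (m ℕ.+ suc n)       ≡⟨ cong fromℕ (ℕ.+-suc m n) ⟩
    fromℕ (m ℕ.+ n) + 1#      ≡⟨ cong (_+ 1#) (fromℕ-+ m n) ⟩
    (fromℕ m + fromℕ n) + 1#  ≡⟨ +-assoc _ _ _ ⟩
    fromℕ m + (fromℕ n + 1#)  ∎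
    where open ≡-Reasoning

  fromℤ-⊖ : ∀ m n → fromℤ (m ℤ.⊖ n) ≡ fromℕ m + - fromℕ n
  fromℤ-⊖ m       zero    = sym (trans (cong (fromℕ m +_) -0#≈0#) (+-identityʳ _))
  fromℤ-⊖ zero    (suc n) = sym (+-identityˡ _)
  fromℤ-⊖ (suc m) (suc n) = begin
    fromℤ (suc m ℤ.⊖ suc n)              ≡⟨ cong fromℤ (ℤ.[1+m]⊖[1+n]≡m⊖n m n) ⟩
    fromℤ (m ℤ.⊖ n)                      ≡⟨ fromℤ-⊖ m n ⟩
    fromℕ m + - fromℕ n                  ≡⟨ sym (+-identityʳ _) ⟩
    (fromℕ m + - fromℕ n) + 0#           ≡⟨ cong (fromℕ m + - fromℕ n +_) (sym (-‿inverseʳ 1#)) ⟩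
    (fromℕ m + - fromℕ n) + (1# + - 1#)  ≡⟨ interchange _ _ _ _ ⟩
    (fromℕ m + 1#) + (- fromℕ n + - 1#)  ≡⟨ cong (fromℕ m + 1# +_) (-‿+-comm _ _) ⟩
    (fromℕ m + 1#) + - (fromℕ n + 1#)    ∎
    where open ≡-Reasoning

  fromℤ-+ : ∀ i j → fromℤ (i ℤ.+ j) ≡ fromℤ i + fromℤ j
  fromℤ-+ (ℤ.+ m)  (ℤ.+ n)  = fromℕ-+ m n
  fromℤ-+ (ℤ.+ m)  -[1+ n ] = fromℤ-⊖ m (suc n)
  fromℤ-+ -[1+ m ] (ℤ.+ n)  = trans (fromℤ-⊖ n (suc m)) (+-comm _ _)
  fromℤ-+ -[1+ m ] -[1+ n ] = begin
    - fromℕ (suc (suc (m ℕ.+ n)))      ≡⟨ cong (λ t → - fromℕ t) (sym (ℕ.+-suc (suc m) n)) ⟩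
    - fromℕ (suc m ℕ.+ suc n)          ≡⟨ cong -_ (fromℕ-+ (suc m) (suc n)) ⟩
    - (fromℕ (suc m) + fromℕ (suc n))  ≡⟨ sym (-‿+-comm _ _) ⟩
    - fromℕ (suc m) + - fromℕ (suc n)  ∎
    where open ≡-Reasoning

  -- If 1 < 0 then 0 < -1, hence 0 < (-1)(-1) = 1.
  0<1 : 0# < 1#
  0<1 with compare 0# 1#
  ... | tri< 0<1 _ _ = 0<1
  ... | tri≈ _ 0≡1 _ = ⊥-elim (0≢1 0≡1)
  ... | tri> _ _ 1<0 = ⊥-elim (irrefl refl (<-trans 1<0 (subst (0# <_) -1*-1≡1 (*-pos 0<-1 0<-1))))
    where
    0<-1 : 0# < - 1#
    0<-1 = subst₂ _<_ (-‿inverseʳ 1#) (+-identityˡ (- 1#)) (+-mono-< (- 1#) 1<0)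
    -1*-1≡1 : - 1# * - 1# ≡ 1#
    -1*-1≡1 = trans (-1*x≈-x (- 1#)) (-‿involutive 1#)

  +-monoˡ-≤ : ∀ {x y} z → x ≤ y → x + z ≤ y + z
  +-monoˡ-≤ z (inj₁ x<y)  = inj₁ (+-mono-< z x<y)
  +-monoˡ-≤ z (inj₂ refl) = inj₂ refl

  +-mono-≤ : ∀ {x y u v} → x ≤ y → u ≤ v → x + u ≤ y + v
  +-mono-≤ {y = y} {u} {v} x≤y u≤v =
    ≤-trans (+-monoˡ-≤ u x≤y) (subst₂ _≤_ (+-comm u y) (+-comm v y) (+-monoˡ-≤ y u≤v))

  0≤fromℕ : ∀ n → 0# ≤ fromℕ n
  0≤fromℕ zero    = inj₂ refl
  0≤fromℕ (suc n) = subst (_≤ fromℕ n + 1#) (+-identityˡ 0#) (+-mono-≤ (0≤fromℕ n) (inj₁ 0<1))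

  -- j = (j - i) + i with j - i a natural number.
  fromℤ-mono-≤ : ∀ {i j} → i ℤ.≤ j → fromℤ i ≤ fromℤ j
  fromℤ-mono-≤ {i} {j} i≤j = subst₂ _≤_ (+-identityˡ (fromℤ i)) fromℤj≡
    (+-monoˡ-≤ (fromℤ i) (0≤fromℕ ℤ.∣ j ℤ.- i ∣))
    where
    open GroupProperties (AbelianGroup.group ℤ.+-0-abelianGroup) using (//-rightDividesˡ)
    fromℤj≡ : fromℕ ℤ.∣ j ℤ.- i ∣ + fromℤ i ≡ fromℤ j
    fromℤj≡ = begin
      fromℕ ℤ.∣ j ℤ.- i ∣ + fromℤ i   ≡⟨ sym (fromℤ-+ (ℤ.+ ℤ.∣ j ℤ.- i ∣) i) ⟩
      fromℤ (ℤ.+ ℤ.∣ j ℤ.- i ∣ ℤ.+ i) ≡⟨ cong (λ t → fromℤ (t ℤ.+ i)) (ℤ.0≤i⇒+∣i∣≡i (ℤ.i≤j⇒0≤j-i i≤j)) ⟩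
      fromℤ ((j ℤ.- i) ℤ.+ i)          ≡⟨ cong fromℤ (//-rightDividesˡ i j) ⟩
      fromℤ j                           ∎
      where open ≡-Reasoning

  ⌊⌋-greatest : ∀ z x → fromℤ z ≤ x → z ℤ.≤ ⌊ x ⌋
  ⌊⌋-greatest z x z≤x with z ℤ.≤? ⌊ x ⌋
  ... | yes z≤⌊x⌋ = z≤⌊x⌋
  ... | no  z≰⌊x⌋ = ⊥-elim (irrefl refl (<-≤-trans (⌊⌋-upper x) (≤-trans ⌊x⌋+1≤z z≤x)))
    where
    ⌊x⌋+1≤z : fromℤ ⌊ x ⌋ + 1# ≤ fromℤ z
    ⌊x⌋+1≤z = subst (_≤ fromℤ z)
      (trans (fromℤ-+ (ℤ.+ 1) ⌊ x ⌋) (trans (+-comm _ _) (cong (fromℤ ⌊ x ⌋ +_) (+-identityˡ 1#))))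
      (fromℤ-mono-≤ (ℤ.i<j⇒suc[i]≤j (ℤ.≰⇒> z≰⌊x⌋)))

  ⌊⌋-superadditive : ∀ x y → ⌊ x ⌋ ℤ.+ ⌊ y ⌋ ℤ.≤ ⌊ x + y ⌋
  ⌊⌋-superadditive x y = ⌊⌋-greatest _ _
    (subst (_≤ x + y) (sym (fromℤ-+ ⌊ x ⌋ ⌊ y ⌋)) (+-mono-≤ (⌊⌋-lower x) (⌊⌋-lower y)))

  ⌊fromℕ/⌋-superadditive : ∀ m n d →
    ⌊ fromℕ m / d ⌋ ℤ.+ ⌊ fromℕ n / d ⌋ ℤ.≤ ⌊ fromℕ (m ℕ.+ n) / d ⌋
  ⌊fromℕ/⌋-superadditive m n d =
    subst (λ x → ⌊ fromℕ m / d ⌋ ℤ.+ ⌊ fromℕ n / d ⌋ ℤ.≤ ⌊ x ⌋) (sym m+n/d≡) (⌊⌋-superadditive _ _)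
    where
    m+n/d≡ : fromℕ (m ℕ.+ n) / d ≡ fromℕ m / d + fromℕ n / d
    m+n/d≡ = trans (cong (_/ d) (fromℕ-+ m n)) (distribʳ (d ⁻¹) _ _)

open import Data.Nat using (_+_; _*_; _^_; _∸_; _≤_; _⊔_)
open import Data.Integer using (+_)

Eventually : (ℕ → Set) → Set
Eventually P = ∃ λ N → ∀ m → N ≤ m → P m

eventually-× : ∀ {P Q} → Eventually P → Eventually Q → Eventually (λ m → P m × Q m)
eventually-× (M , P-from-M) (N , Q-from-N) = M ⊔ N , λ m M⊔N≤m →
  P-from-M m (ℕ.m⊔n≤o⇒m≤o M N M⊔N≤m) , Q-from-N m (ℕ.m⊔n≤o⇒n≤o M N M⊔N≤m)

eventually⇒∃ : ∀ {P} → Eventually P → ∃ P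
eventually⇒∃ (N , P-from-N) = N , P-from-N N ℕ.≤-refl

^-monoʳ-∣ : ∀ p {m n} → m ≤ n → p ^ m ∣ p ^ n
^-monoʳ-∣ p {m} {n} m≤n = divides (p ^ (n ∸ m)) (begin
  p ^ n                ≡⟨ cong (p ^_) (sym (ℕ.m∸n+n≡m m≤n)) ⟩
  p ^ (n ∸ m + m)      ≡⟨ ℕ.^-distribˡ-+-* p (n ∸ m) m ⟩
  p ^ (n ∸ m) * p ^ m  ∎)
  where open ≡-Reasoning

module Exponents (R : RealField) (f : RealField.Carrier R → RealField.Carrier R) where
  open FFactorial R
  open RealFieldProperties R using (⌊fromℕ/⌋-superadditive)
  open CommutativeSemigroupProperties ℤ.+-commutativeSemigroup using (interchange)

  partialSum-superadditive : ∀ p n k K →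
    partialSum f p n K ℤ.+ partialSum f p k K ℤ.≤ partialSum f p (n + k) K
  partialSum-superadditive p n k zero    = ℤ.≤-refl
  partialSum-superadditive p n k (suc K) = begin
    (partialSum f p n K ℤ.+ term f p n K) ℤ.+ (partialSum f p k K ℤ.+ term f p k K)
      ≡⟨ interchange (partialSum f p n K) (term f p n K) (partialSum f p k K) (term f p k K) ⟩
    (partialSum f p n K ℤ.+ partialSum f p k K) ℤ.+ (term f p n K ℤ.+ term f p k K)
      ≤⟨ ℤ.+-mono-≤ (partialSum-superadditive p n k K) (⌊fromℕ/⌋-superadditive n k _) ⟩
    partialSum f p (n + k) K ℤ.+ term f p (n + k) K
      ∎
    where open ℤ.≤-Reasoning

  partialSum-stable : ∀ p n K → (∀ k → K ≤ k → term f p n k ≡ + 0) →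
    ∀ d → partialSum f p n (d + K) ≡ partialSum f p n K
  partialSum-stable p n K vanish zero    = refl
  partialSum-stable p n K vanish (suc d) = begin
    partialSum f p n (d + K) ℤ.+ term f p n (d + K)
      ≡⟨ cong (λ t → partialSum f p n (d + K) ℤ.+ t) (vanish (d + K) (ℕ.m≤n+m K d)) ⟩
    partialSum f p n (d + K) ℤ.+ + 0
      ≡⟨ ℤ.+-identityʳ _ ⟩
    partialSum f p n (d + K)
      ≡⟨ partialSum-stable p n K vanish d ⟩
    partialSum f p n K
      ∎
    where open ≡-Reasoning

  HasExponent⇒eventually : ∀ {p n e} → HasExponent f p n e →
    Eventually (λ K → partialSum f p n K ≡ + e)
  HasExponent⇒eventually {p} {n} {e} (K , vanish , partialSum≡e) = K , λ K′ K≤K′ → begin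
    partialSum f p n K′            ≡⟨ cong (partialSum f p n) (sym (ℕ.m∸n+n≡m K≤K′)) ⟩
    partialSum f p n (K′ ∸ K + K)  ≡⟨ partialSum-stable p n K vanish (K′ ∸ K) ⟩
    partialSum f p n K             ≡⟨ partialSum≡e ⟩
    + e                            ∎
    where open ≡-Reasoning

  exponent-superadditive : ∀ {p n k a b c} → HasExponent f p n a → HasExponent f p k b →
    HasExponent f p (n + k) c → a + b ≤ c
  exponent-superadditive {p} {n} {k} ha hb hc
    with eventually⇒∃ (eventually-× (HasExponent⇒eventually ha)
                        (eventually-× (HasExponent⇒eventually hb) (HasExponent⇒eventually hc)))
  ... | K , Sn≡a , Sk≡b , Sn+k≡c =
    ℤ.drop‿+≤+ (subst₂ ℤ._≤_ (cong₂ ℤ._+_ Sn≡a Sk≡b) Sn+k≡c (partialSum-superadditive p n k K))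

module PrimeProducts (R : RealField) where
  open FFactorial R using (primeProduct)
  open CommutativeSemigroupProperties ℕ.*-commutativeSemigroup using (interchange)

  primeProduct-*-∣ : ∀ ea eb ec → (∀ p → Prime p → ea p + eb p ≤ ec p) →
    ∀ B → primeProduct ea B * primeProduct eb B ∣ primeProduct ec B
  primeProduct-*-∣ ea eb ec ea+eb≤ec zero = ∣-refl
  primeProduct-*-∣ ea eb ec ea+eb≤ec (suc B) with prime? (suc B)
  ... | no  _     = primeProduct-*-∣ ea eb ec ea+eb≤ec B
  ... | yes p-prime = subst (_∣ Π ec * p^ ec) (interchange (Π ea) (Π eb) (p^ ea) (p^ eb))
    (*-pres-∣ (primeProduct-*-∣ ea eb ec ea+eb≤ec B)
      (subst (_∣ p^ ec) (ℕ.^-distribˡ-+-* (suc B) (ea (suc B)) (eb (suc B)))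
        (^-monoʳ-∣ (suc B) (ea+eb≤ec (suc B) p-prime))))
    where
    Π p^ : (ℕ → ℕ) → ℕ
    Π e  = primeProduct e B
    p^ e = suc B ^ e (suc B)

open Exponents using (exponent-superadditive)
open PrimeProducts using (primeProduct-*-∣)

corollary10 : (R : RealField) → (f : RealField.Carrier R → RealField.Carrier R) →
    FFactorial.PositiveOnPrimes R f →
    (∀ m → ∃ λ N → FFactorial.IsFFact R f m N) →
    ∀ n k a b c → FFactorial.IsFFact R f n a → FFactorial.IsFFact R f k b →
    FFactorial.IsFFact R f (n + k) c → a * b ∣ c
corollary10 R f _ _ n k a b c (ea , ha , Πa-eventually) (eb , hb , Πb-eventually) (ec , hc , Πc-eventually)
  with eventually⇒∃ (eventually-× Πa-eventually (eventually-× Πb-eventually Πc-eventually))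
... | B , Πa≡a , Πb≡b , Πc≡c =
  subst₂ _∣_ (cong₂ _*_ Πa≡a Πb≡b) Πc≡c (primeProduct-*-∣ R ea eb ec ea+eb≤ec B)
  where
  ea+eb≤ec : ∀ p → Prime p → ea p + eb p ≤ ec p
  ea+eb≤ec p p-prime = exponent-superadditive R f (ha p p-prime) (hb p p-prime) (hc p p-prime)
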